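{- For all integers $n,p\ge 0$, \[ \mathrm{Bel}_{n,\lambda}^{(p)}(x)=\sum_{k=0}^{n}\frac{S_{2,\lambda}(n,k)}{\binom{k+p}{k}}\,x^{k}. \]
   Context: Let $\lambda\in\mathbb{R}$. Set $(x)_{0,\lambda}=1$ and $(x)_{n,\lambda}=x(x-\lambda)\cdots(x-(n-1)\lambda)$ for $n\ge1$; also $(x)_0=1$, $(x)_n=x(x-1)\cdots(x-n+1)$. The degenerate exponential is the formal power series $e_\lambda^x(t)=\sum_{n\ge0}(x)_{n,\lambda}\frac{t^n}{n!}$ (equal to $(1+\lambda t)^{x/\lambda}$, and to $e^{xt}$ when $\lambda=0$), and $e_\lambda(t)=e_\lambda^1(t)$. The degenerate Stirling numbers of the second kind $S_{2,\lambda}(n,k)$ are defined by $(x)_{n,\lambda}=\sum_{k=0}^n S_{2,\lambda}(n,k)(x)_k$; equivalently $\frac{1}{k!}(e_\lambda(t)-1)^k=\sum_{n\ge k}S_{2,\lambda}(n,k)\frac{t^n}{n!}$. For an integer $p\ge0$, the truncated degenerate Bell polynomials $\mathrm{Bel}^{(p)}_{n,\lambda}(x)$ are defined by \[\sum_{n\ge0}\mathrm{Bel}^{(p)}_{n,\lambda}(x)\frac{t^n}{n!}=\frac{p!}{x^p(e_\lambda(t)-1)^p}\Big(e^{x(e_\lambda(t)-1)}-\sum_{k=0}^{p-1}\frac{x^k(e_\lambda(t)-1)^k}{k!}\Big),\] i.e. as formal power series the right-hand side is $p!\sum_{k\ge0}\frac{x^k(e_\lambda(t)-1)^k}{(k+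p)!}$.
   Formalization: The parameter λ ranges over ℚ instead of ℝ, and the identity is asserted only for rational values of x. -}

module Defs where

open import Data.Nat as ℕ using (ℕ; zero; suc; _∸_)
open import Data.Nat.Combinatorics using (_C_)
open import Data.Nat using (_!)
open import Data.Integer using (+_)
open import Data.Rational using (ℚ; _/_; _+_; _*_; _-_; 0ℚ; 1ℚ)

ℕ→ℚ : ℕ → ℚ
ℕ→ℚ n = + n / 1

-- reciprocal of a natural number (only ever applied to nonzero arguments;
-- the value at 0 is an irrelevant convention)
recipℕ : ℕ → ℚ
recipℕ zero    = 0ℚ
recipℕ (suc m) = + 1 / suc m

_^_ : ℚ → ℕ → ℚ
x ^ zero  = 1ℚ
x ^ suc n = x * (x ^ n)

sumTo : (ℕ → ℚ) → ℕ → ℚ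
sumTo f zero    = f zero
sumTo f (suc n) = sumTo f n + f (suc n)

-- formal power series over ℚ, as coefficient sequences (t^n ↦ coefficient)
PS : Set
PS = ℕ → ℚ

oneS : PS
oneS zero    = 1ℚ
oneS (suc _) = 0ℚ

_⊛_ : PS → PS → PS
(f ⊛ g) n = sumTo (λ i → f i * g (n ∸ i)) n

powS : PS → ℕ → PS
powS f zero    = oneS
powS f (suc k) = f ⊛ powS f k

fallλ : ℚ → ℚ → ℕ → ℚ
fallλ λ' x zero    = 1ℚ
fallλ λ' x (suc n) = fallλ λ' x n * (x - ℕ→ℚ n * λ')

eλ : ℚ → PS
eλ λ' n = fallλ λ' 1ℚ n * recipℕ (n !)

eλ-1 : ℚ → PS
eλ-1 λ' zero    = 0ℚ
eλ-1 λ' (suc n) = eλ λ' (suc n)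

-- degenerate Stirling numbers of the second kind, via
-- (1/k!) (e_λ(t)-1)^k = Σ_n S_{2,λ}(n,k) t^n/n!
S2λ : ℚ → ℕ → ℕ → ℚ
S2λ λ' n k = ℕ→ℚ (n !) * (recipℕ (k !) * powS (eλ-1 λ') k n)

-- truncated degenerate Bell polynomials: n! times the coefficient of t^n in
-- p! Σ_{k≥0} x^k (e_λ(t)-1)^k / (k+p)!.  Since (e_λ(t)-1)^k has order ≥ k,
-- only k ≤ n contribute to the coefficient of t^n.
Belλ : ℕ → ℚ → ℚ → ℕ → ℚ
Belλ p λ' x n =
  ℕ→ℚ (n !) * (ℕ→ℚ (p !) *
    sumTo (λ k → (x ^ k) * (recipℕ ((k ℕ.+ p) !) * powS (eλ-1 λ') k n)) n)

{-# OPTIONS --safe #-}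
module Submission where

-- The coefficient of x^k in Bel^(p)_{n,λ}(x) is n! · p!/(k+p)! · [t^n](e_λ(t) - 1)^k.
-- Since (k+p)! = C(k+p,k) · k! · p!, this equals n!/k! · [t^n](e_λ(t) - 1)^k / C(k+p,k),
-- and n!/k! · [t^n](e_λ(t) - 1)^k is S_{2,λ}(n,k).

open import Defs
open import Data.Nat using (ℕ; _+_)
open import Data.Nat.Combinatorics using (_C_)
open import Data.Rational using (ℚ; _*_)
open import Relation.Binary.PropositionalEquality using (_≡_)

open import Data.Nat as ℕ using (zero; suc; _!; _∸_; _≤_; NonZero)
import Data.Nat.Properties as ℕ
open import Data.Nat.Combinatorics using (nCk≡n!/k![n-k]!; k![n∸k]!∣n!)
open import Data.Nat.DivMod using (m/n*n≡m)
open import Data.Integer using (+_)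
open import Data.Rational as ℚ using (1ℚ; toℚᵘ; fromℚᵘ)
open import Data.Rational.Properties
  using ( toℚᵘ-injective; toℚᵘ-fromℚᵘ; toℚᵘ-homo-*; fromℚᵘ-cong
        ; *-zeroˡ; *-zeroʳ; *-identityʳ; *-distribˡ-+)
open import Data.Rational.Unnormalised as ℚᵘ using (mkℚᵘ)
import Data.Rational.Unnormalised.Properties as ℚᵘ
open import Data.Rational.Solver using (module +-*-Solver)
open import Relation.Binary.PropositionalEquality
  using (refl; sym; trans; cong; cong₂; subst; module ≡-Reasoning)

fromℚᵘ-homo-* : ∀ p q → fromℚᵘ (p ℚᵘ.* q) ≡ fromℚᵘ p * fromℚᵘ q
fromℚᵘ-homo-* p q = toℚᵘ-injective (begin
  toℚᵘ (fromℚᵘ (p ℚᵘ.* q))              ≈⟨ toℚᵘ-fromℚᵘ (p ℚᵘ.* q) ⟩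
  p ℚᵘ.* q                               ≈⟨ ℚᵘ.*-cong (toℚᵘ-fromℚᵘ p) (toℚᵘ-fromℚᵘ q) ⟨
  toℚᵘ (fromℚᵘ p) ℚᵘ.* toℚᵘ (fromℚᵘ q) ≈⟨ toℚᵘ-homo-* (fromℚᵘ p) (fromℚᵘ q) ⟨
  toℚᵘ (fromℚᵘ p * fromℚᵘ q)            ∎)
  where open ℚᵘ.≃-Reasoning

-- ℚᵘ's reciprocal of mkℚᵘ (+ suc m) 0 is mkℚᵘ (+ 1) m on the nose.
ℕ→ℚ*recipℕ≡1 : ∀ n .{{_ : NonZero n}} → ℕ→ℚ n * recipℕ n ≡ 1ℚ
ℕ→ℚ*recipℕ≡1 (suc m) =
  trans (sym (fromℚᵘ-homo-* n (ℚᵘ.1/ n))) (fromℚᵘ-cong (ℚᵘ.*-inverseʳ n))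
  where n = mkℚᵘ (+ suc m) 0

recipℕ-homo-* : ∀ m n → recipℕ (m ℕ.* n) ≡ recipℕ m * recipℕ n
recipℕ-homo-* zero    n       = sym (*-zeroˡ (recipℕ n))
recipℕ-homo-* (suc m) zero    = trans (cong recipℕ (ℕ.*-zeroʳ m)) (sym (*-zeroʳ (recipℕ (suc m))))
recipℕ-homo-* (suc m) (suc n) = fromℚᵘ-homo-* (mkℚᵘ (+ 1) m) (mkℚᵘ (+ 1) n)

nCk*[k!*[n∸k]!]≡n! : ∀ {n k} → k ≤ n → (n C k) ℕ.* (k ! ℕ.* (n ∸ k) !) ≡ n !
nCk*[k!*[n∸k]!]≡n! {n} {k} k≤n = trans
  (cong (ℕ._* (k ! ℕ.* (n ∸ k) !)) (nCk≡n!/k![n-k]! k≤n))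
  (m/n*n≡m {{ℕ._!*_!≢0 k (n ∸ k)}} (k![n∸k]!∣n! k≤n))

[k+p]Ck*[k!*p!]≡[k+p]! : ∀ k p → ((k + p) C k) ℕ.* (k ! ℕ.* p !) ≡ (k + p) !
[k+p]Ck*[k!*p!]≡[k+p]! k p =
  subst (λ q → ((k + p) C k) ℕ.* (k ! ℕ.* q !) ≡ (k + p) !)
        (ℕ.m+n∸m≡n k p) (nCk*[k!*[n∸k]!]≡n! (ℕ.m≤m+n k p))

p!/[k+p]!≡1/[k!*[k+p]Ck] : ∀ k p →
  ℕ→ℚ (p !) * recipℕ ((k + p) !) ≡ recipℕ (k !) * recipℕ ((k + p) C k)
p!/[k+p]!≡1/[k!*[k+p]Ck] k p = begin
  ℕ→ℚ (p !) * recipℕ ((k + p) !)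
    ≡⟨ cong (λ m → ℕ→ℚ (p !) * recipℕ m) ([k+p]Ck*[k!*p!]≡[k+p]! k p) ⟨
  ℕ→ℚ (p !) * recipℕ (b ℕ.* (k ! ℕ.* p !))
    ≡⟨ cong (ℕ→ℚ (p !) *_) (trans (recipℕ-homo-* b _)
                                  (cong (recipℕ b *_) (recipℕ-homo-* (k !) (p !)))) ⟩
  ℕ→ℚ (p !) * (recipℕ b * (recipℕ (k !) * recipℕ (p !)))
    ≡⟨ solve 4 (λ p! c k! r → p! :* (c :* (k! :* r)) := (k! :* c) :* (p! :* r))
               refl (ℕ→ℚ (p !)) (recipℕ b) (recipℕ (k !)) (recipℕ (p !)) ⟩
  (recipℕ (k !) * recipℕ b) * (ℕ→ℚ (p !) * recipℕ (p !))
    ≡⟨ cong (recipℕ (k !) * recipℕ b *_) (ℕ→ℚ*recipℕ≡1 (p !) {{ℕ._!≢0 p}}) ⟩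
  (recipℕ (k !) * recipℕ b) * 1ℚ
    ≡⟨ *-identityʳ _ ⟩
  recipℕ (k !) * recipℕ b ∎
  where
  open ≡-Reasoning
  open +-*-Solver
  b = (k + p) C k

*-distribˡ-sumTo : ∀ c f n → c * sumTo f n ≡ sumTo (λ k → c * f k) n
*-distribˡ-sumTo c f zero    = refl
*-distribˡ-sumTo c f (suc n) = trans (*-distribˡ-+ c (sumTo f n) (f (suc n)))
  (cong (ℚ._+ c * f (suc n)) (*-distribˡ-sumTo c f n))

sumTo-cong : ∀ {f g} n → (∀ k → f k ≡ g k) → sumTo f n ≡ sumTo g n
sumTo-cong zero    f≗g = f≗g 0
sumTo-cong (suc n) f≗g = cong₂ ℚ._+_ (sumTo-cong n f≗g) (f≗g (suc n))

theorem1 : (λ' x : ℚ) (n p : ℕ) →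
    Belλ p λ' x n ≡ sumTo (λ k → (S2λ λ' n k * recipℕ ((k + p) C k)) * (x ^ k)) n
theorem1 λ' x n p = begin
  n! * (p! * sumTo F n)           ≡⟨ cong (n! *_) (*-distribˡ-sumTo p! F n) ⟩
  n! * sumTo (λ k → p! * F k) n   ≡⟨ *-distribˡ-sumTo n! _ n ⟩
  sumTo (λ k → n! * (p! * F k)) n ≡⟨ sumTo-cong n term ⟩
  sumTo (λ k → (S2λ λ' n k * recipℕ ((k + p) C k)) * (x ^ k)) n ∎
  where
  open ≡-Reasoning
  open +-*-Solver
  n! = ℕ→ℚ (n !)
  p! = ℕ→ℚ (p !)
  F : ℕ → ℚ
  F k = (x ^ k) * (recipℕ ((k + p) !) * powS (eλ-1 λ') k n)
  term : ∀ k → n! * (p! * F k) ≡ (S2λ λ' n k * recipℕ ((k + p) C k)) * (x ^ k)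
  term k = begin
    n! * (p! * (x ^ k * (recipℕ ((k + p) !) * e)))
      ≡⟨ solve 5 (λ a b c d e → a :* (b :* (c :* (d :* e))) := (a :* (b :* d)) :* e :* c)
               refl n! p! (x ^ k) (recipℕ ((k + p) !)) e ⟩
    n! * (p! * recipℕ ((k + p) !)) * e * x ^ k
      ≡⟨ cong (λ r → n! * r * e * x ^ k) (p!/[k+p]!≡1/[k!*[k+p]Ck] k p) ⟩
    n! * (recipℕ (k !) * recipℕ ((k + p) C k)) * e * x ^ k
      ≡⟨ solve 5 (λ a b c d e → a :* (b :* c) :* d :* e := a :* (b :* d) :* c :* e)
               refl n! (recipℕ (k !)) (recipℕ ((k + p) C k)) e (x ^ k) ⟩
    S2λ λ' n k * recipℕ ((k + p) C k) * x ^ k ∎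
    where e = powS (eλ-1 λ') k n
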